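{- Let $(V^{\sf small},V^{\sf large})$ be an $\alpha$-valuation of the complete bipartite graph $K_{a,a}$. Then, regarding the labels as elements of $\mathbb{Z}_{a^2+1}$, the pair $(V^{\sf small},V^{\sf large})$ is an $(a^2+1,2,a;1)$-SEDF in the cyclic group $\mathbb{Z}_{a^2+1}$.
   Context: An $\alpha$-valuation of $K_{a,a}$ is a one-to-one labelling of its vertices by elements of $\{0,1,\dots,a^2\}$ such that the absolute differences of endpoint labels over all edges are exactly $\{1,\dots,a^2\}$, and there is a value $x$ such that every edge joins a vertex with label $\le x$ to one with label $>x$; $V^{\sf small}$ and $V^{\sf large}$ are the sets of labels $\le x$ and $>x$. For disjoint subsets $A,B$ of an additive group $G$, $\mathcal{D}(B,A)$ is the multiset $\{y-x: y\in B, x\in A\}$. For an additive group $G$ of order $n$ and $m\ge 2$, an $(n,m,\ell;\lambda)$-strong external difference family (SEDF) is a tuple $(A_0,\dots,A_{m-1})$ of pairwise disjoint $\ell$-subsets of $G$ such that for every $i$, the multiset union $\bigcup_{j\ne i}\mathcal{D}(A_i,A_j)$ equals $\lambda$ copies of $G\setminus\{0\}$. -}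

module Defs where

open import Data.Nat using (ℕ; zero; suc; _+_; _*_; _∸_; _≤_; _<_; _≤?_; NonZero; ∣_-_∣)
import Data.Nat as ℕ
open import Data.Nat.DivMod using (_mod_)
open import Data.Fin using (Fin; toℕ)
open import Data.Fin.Properties using () renaming (_≟_ to _≟F_)
open import Data.Sum using (_⊎_; inj₁; inj₂)
open import Data.Product using (_×_; ∃₂)
open import Data.List using (List; map; filter; _++_; concat; concatMap; replicate; length; allFin)
open import Data.List.Relation.Unary.Unique.Propositional using (Unique)
open import Data.List.Membership.Propositional using (_∈_)
open import Data.List.Relation.Binary.Permutation.Propositional using (_↭_)
open import Relation.Nullary using (¬_; ¬?)
open import Relation.Binary.PropositionalEquality using (_≡_; _≢_)

-- K_{a,a}: vertices are  Fin a ⊎ Fin a  (two parts); edges are all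
-- pairs (inj₁ i , inj₂ j).  A labelling is  f : Fin a ⊎ Fin a → ℕ.

Vertex : ℕ → Set
Vertex a = Fin a ⊎ Fin a

allVertices : (a : ℕ) → List (Vertex a)
allVertices a = map inj₁ (allFin a) ++ map inj₂ (allFin a)

record IsAlphaValuation (a : ℕ) (f : Vertex a → ℕ) (x : ℕ) : Set where
  field
    injective  : ∀ u v → f u ≡ f v → u ≡ v
    bounded    : ∀ u → f u ≤ a * a
    diffs-in   : ∀ i j → 1 ≤ ∣ f (inj₁ i) - f (inj₂ j) ∣ × ∣ f (inj₁ i) - f (inj₂ j) ∣ ≤ a * a
    diffs-onto : ∀ d → 1 ≤ d → d ≤ a * a → ∃₂ λ i j → ∣ f (inj₁ i) - f (inj₂ j) ∣ ≡ d
    threshold  : ∀ i j → (f (inj₁ i) ≤ x × x < f (inj₂ j)) ⊎ (f (inj₂ j) ≤ x × x < f (inj₁ i))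

Vsmall : (a : ℕ) (f : Vertex a → ℕ) (x : ℕ) → List (Fin (suc (a * a)))
Vsmall a f x = map (λ v → f v mod suc (a * a)) (filter (λ v → f v ≤? x) (allVertices a))

Vlarge : (a : ℕ) (f : Vertex a → ℕ) (x : ℕ) → List (Fin (suc (a * a)))
Vlarge a f x = map (λ v → f v mod suc (a * a)) (filter (λ v → ¬? (f v ≤? x)) (allVertices a))

_⊖_ : {n : ℕ} .{{_ : NonZero n}} → Fin n → Fin n → Fin n
_⊖_ {n} y z = (toℕ y + (n ∸ toℕ z)) mod n

D : {n : ℕ} .{{_ : NonZero n}} → List (Fin n) → List (Fin n) → List (Fin n)
D B A = concatMap (λ y → map (λ z → y ⊖ z) A) B

nonzeros : (n : ℕ) → List (Fin n)
nonzeros n = filter (λ g → ¬? (toℕ g ℕ.≟ 0)) (allFin n)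

-- (n,m,ℓ;λ)-SEDF in ℤ_n; multiset equality is permutation (_↭_).
record IsSEDF (n m ℓ λ' : ℕ) .{{_ : NonZero n}} (A : Fin m → List (Fin n)) : Set where
  field
    m≥2        : 2 ≤ m
    sizes      : ∀ i → length (A i) ≡ ℓ
    distinct   : ∀ i → Unique (A i)
    disjoint   : ∀ i j → i ≢ j → ∀ g → g ∈ A i → ¬ (g ∈ A j)
    difference : ∀ i →
      concatMap (λ j → D (A i) (A j)) (filter (λ j → ¬? (j ≟F i)) (allFin m))
        ↭ concat (replicate λ' (nonzeros n))

pair : {X : Set} → X → X → Fin 2 → X
pair A B Fin.zero = A
pair A B (Fin.suc _) = B

{-# OPTIONS --safe #-}
-- In an α-valuation of K_{a,a} with threshold x, one side of the bipartition is labelled ≤ x and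
-- the other > x, so V^small and V^large each have a elements, and the a² differences
-- large − small are exactly 1, …, a². Read in ℤ_{a²+1} these are all nonzero elements, each
-- once; their negatives small − large are again all nonzero elements, since −d = (a²+1) − d.
module Submission where

open import Defs
open import Data.Nat using (ℕ; zero; suc; _+_; _*_; _∸_; _≤_; _<_; s≤s; s≤s⁻¹; NonZero)
open import Data.Nat.Properties
open import Data.Nat.DivMod using (_mod_; _%_; m<n⇒m%n≡m; [m+n]%n≡m%n)
open import Data.Fin as Fin using (Fin; zero; suc; toℕ)
open import Data.Fin.Properties using (toℕ-fromℕ<; toℕ-injective; toℕ<n)
open import Data.Sum using (_⊎_; inj₁; inj₂; [_,_])
open import Data.Sum.Properties using (inj₁-injective; inj₂-injective)
open import Data.Product using (_×_; _,_; proj₁; proj₂)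
open import Data.List using (List; []; _∷_; map; filter; _++_; length; allFin)
open import Data.List.Properties using (length-map; length-++; length-tabulate; filter-++; filter-all; filter-none; ++-identityʳ)
open import Data.List.Relation.Unary.All as All using (All)
import Data.List.Relation.Unary.All.Properties as Allₚ
open import Data.List.Relation.Unary.Any using (here; there)
open import Data.List.Relation.Unary.AllPairs using (_∷_)
open import Data.List.Relation.Unary.Unique.Propositional using (Unique)
import Data.List.Relation.Unary.Unique.Propositional.Properties as Uniqueₚ
open import Data.List.Membership.Propositional using (_∈_)
open import Data.List.Membership.Propositional.Properties
  using (∈-∃++; ∈-map⁺; ∈-map⁻; ∈-++⁺ˡ; ∈-++⁺ʳ; ∈-allFin; ∈-filter⁺; ∈-filter⁻; ∈-map∘filter⁻)
open import Data.List.Relation.Binary.Subset.Propositional using (_⊆_)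
open import Data.List.Relation.Binary.Permutation.Propositional using (_↭_; ↭-refl; ↭-prep; ↭-trans; ↭-sym)
open import Data.List.Relation.Binary.Permutation.Propositional.Properties using (∈-resp-↭; ↭-length; shift; ++⁺ʳ)
open import Relation.Nullary using (¬_; ¬?; contradiction)
open import Relation.Unary using (Pred; Decidable; ∁)
open import Relation.Binary.PropositionalEquality using (_≡_; refl; sym; trans; cong; cong₂; subst; subst₂; module ≡-Reasoning)
open import Function using (id)
open import Level using (0ℓ)

open ≡-Reasoning

unique-⊆-length≤⇒↭ : {A : Set} {xs ys : List A} → Unique xs → xs ⊆ ys → length ys ≤ length xs → xs ↭ ys
unique-⊆-length≤⇒↭ {xs = []} {[]} _ _ _ = ↭-refl
unique-⊆-length≤⇒↭ {xs = []} {_ ∷ _} _ _ ()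
unique-⊆-length≤⇒↭ {xs = x ∷ xs} (x∉xs ∷ xs!) xs⊆ys |ys|≤ with ∈-∃++ (xs⊆ys (here refl))
... | us , vs , refl = ↭-trans (↭-prep x (unique-⊆-length≤⇒↭ xs! xs⊆us++vs |us++vs|≤)) (↭-sym (shift x us vs))
  where
  xs⊆us++vs : xs ⊆ us ++ vs
  xs⊆us++vs z∈xs with ∈-resp-↭ (shift x us vs) (xs⊆ys (there z∈xs))
  ... | here refl = contradiction refl (All.lookup x∉xs z∈xs)
  ... | there z∈us++vs = z∈us++vs
  |us++vs|≤ : length (us ++ vs) ≤ length xs
  |us++vs|≤ = s≤s⁻¹ (subst (_≤ suc (length xs)) (↭-length (shift x us vs)) |ys|≤)

module _ {A : Set} {P : Pred A 0ℓ} (P? : Decidable P) {xs ys : List A} where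

  filter-++-accept-reject : All P xs → All (∁ P) ys → filter P? (xs ++ ys) ≡ xs
  filter-++-accept-reject pxs ¬pys = begin
    filter P? (xs ++ ys)            ≡⟨ filter-++ P? xs ys ⟩
    filter P? xs ++ filter P? ys    ≡⟨ cong₂ _++_ (filter-all P? pxs) (filter-none P? ¬pys) ⟩
    xs ++ []                        ≡⟨ ++-identityʳ xs ⟩
    xs                              ∎

  filter-++-reject-accept : All (∁ P) xs → All P ys → filter P? (xs ++ ys) ≡ ys
  filter-++-reject-accept ¬pxs pys = trans (filter-++ P? xs ys) (cong₂ _++_ (filter-none P? ¬pxs) (filter-all P? pys))

Separates : {I J : Set} → Pred (I ⊎ J) 0ℓ → Set
Separates P = ∀ i j → (P (inj₁ i) × ¬ P (inj₂ j)) ⊎ (¬ P (inj₁ i) × P (inj₂ j))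

module _ {I J : Set} {P : Pred (I ⊎ J) 0ℓ} (sep : Separates P) where

  ¬-separates : Separates (∁ P)
  ¬-separates i j with sep i j
  ... | inj₁ (p , ¬q) = inj₂ ((λ ¬p → ¬p p) , ¬q)
  ... | inj₂ (¬p , q) = inj₁ (¬p , λ ¬q → ¬q q)

  -- The points i₀, j₀ are needed: if I is empty, nothing ties together the values of P on J.
  separates⇒sides : I → J → ((∀ i → P (inj₁ i)) × (∀ j → ¬ P (inj₂ j)))
                          ⊎ ((∀ i → ¬ P (inj₁ i)) × (∀ j → P (inj₂ j)))
  separates⇒sides i₀ j₀ with sep i₀ j₀
  ... | inj₁ (p , ¬q) = inj₁ ( (λ i → [ proj₁ , (λ (_ , q) → contradiction q ¬q) ] (sep i j₀))
                             , (λ j → [ proj₂ , (λ (¬p , _) → contradiction p ¬p) ] (sep i₀ j)) )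
  ... | inj₂ (¬p , q) = inj₂ ( (λ i → [ (λ (_ , ¬q) → contradiction q ¬q) , proj₁ ] (sep i j₀))
                             , (λ j → [ (λ (p , _) → contradiction p ¬p) , proj₂ ] (sep i₀ j)) )

module _ {a : ℕ} {B : Set} (g : Fin a → B) where

  All-map-allFin : {Q : Pred B 0ℓ} → (∀ i → Q (g i)) → All Q (map g (allFin a))
  All-map-allFin q = Allₚ.map⁺ (Allₚ.tabulate⁺ q)

  length-map-allFin : length (map g (allFin a)) ≡ a
  length-map-allFin = trans (length-map g (allFin a)) (length-tabulate id)

allVertices-unique : ∀ a → Unique (allVertices a)
allVertices-unique a = Uniqueₚ.++⁺ (Uniqueₚ.map⁺ inj₁-injective (Uniqueₚ.allFin⁺ a))
                                   (Uniqueₚ.map⁺ inj₂-injective (Uniqueₚ.allFin⁺ a)) left∩right≡∅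
  where
  left∩right≡∅ : ∀ {v} → ¬ (v ∈ map inj₁ (allFin a) × v ∈ map inj₂ (allFin a))
  left∩right≡∅ (p , q) with ∈-map⁻ inj₁ p | ∈-map⁻ inj₂ q
  ... | _ , _ , refl | _ , _ , ()

∈-allVertices : ∀ {a} (v : Vertex a) → v ∈ allVertices a
∈-allVertices {a} (inj₁ i) = ∈-++⁺ˡ (∈-map⁺ inj₁ (∈-allFin i))
∈-allVertices {a} (inj₂ j) = ∈-++⁺ʳ (map inj₁ (allFin a)) (∈-map⁺ inj₂ (∈-allFin j))

length-filter-separating : ∀ {a} {P : Pred (Vertex a) 0ℓ} (P? : Decidable P) → Separates P →
                           length (filter P? (allVertices a)) ≡ a
length-filter-separating {zero} P? _ = refl
length-filter-separating {suc a} {P} P? sep with separates⇒sides {P = P} sep zero zero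
... | inj₁ (left , right) = trans
  (cong length (filter-++-accept-reject P? (All-map-allFin inj₁ {Q = P} left) (All-map-allFin inj₂ {Q = ∁ P} right)))
  (length-map-allFin inj₁)
... | inj₂ (left , right) = trans
  (cong length (filter-++-reject-accept P? (All-map-allFin inj₁ {Q = ∁ P} left) (All-map-allFin inj₂ {Q = P} right)))
  (length-map-allFin inj₂)

m∸[n∸o]≡o+[m∸n] : ∀ {m n o} → n ≤ m → o ≤ n → m ∸ (n ∸ o) ≡ o + (m ∸ n)
m∸[n∸o]≡o+[m∸n] {m} {n} {o} n≤m o≤n = begin
  m ∸ (n ∸ o)             ≡⟨ cong (_∸ (n ∸ o)) (m∸n+n≡m n≤m) ⟨
  (m ∸ n) + n ∸ (n ∸ o)   ≡⟨ +-∸-assoc (m ∸ n) (m∸n≤m n o) ⟩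
  (m ∸ n) + (n ∸ (n ∸ o)) ≡⟨ cong ((m ∸ n) +_) (m∸[m∸n]≡n o≤n) ⟩
  (m ∸ n) + o             ≡⟨ +-comm (m ∸ n) o ⟩
  o + (m ∸ n)             ∎

module _ {n : ℕ} .{{_ : NonZero n}} where

  toℕ-mod : ∀ {m} → m < n → toℕ (m mod n) ≡ m
  toℕ-mod m<n = trans (toℕ-fromℕ< _) (m<n⇒m%n≡m m<n)

  toℕ-⊖-≥ : ∀ {y z : Fin n} → toℕ z ≤ toℕ y → toℕ (y ⊖ z) ≡ toℕ y ∸ toℕ z
  toℕ-⊖-≥ {y} {z} z≤y = begin
    toℕ (y ⊖ z)                ≡⟨ toℕ-fromℕ< _ ⟩
    (toℕ y + (n ∸ toℕ z)) % n  ≡⟨ cong (_% n) (+-∸-assoc (toℕ y) (<⇒≤ (toℕ<n z))) ⟨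
    (toℕ y + n ∸ toℕ z) % n    ≡⟨ cong (_% n) (+-∸-comm n z≤y) ⟩
    (toℕ y ∸ toℕ z + n) % n    ≡⟨ [m+n]%n≡m%n (toℕ y ∸ toℕ z) n ⟩
    (toℕ y ∸ toℕ z) % n        ≡⟨ m<n⇒m%n≡m (≤-<-trans (m∸n≤m (toℕ y) (toℕ z)) (toℕ<n y)) ⟩
    toℕ y ∸ toℕ z              ∎

  toℕ-⊖-< : ∀ {y z : Fin n} → toℕ y < toℕ z → toℕ (y ⊖ z) ≡ n ∸ (toℕ z ∸ toℕ y)
  toℕ-⊖-< {y} {z} y<z = begin
    toℕ (y ⊖ z)                ≡⟨ toℕ-fromℕ< _ ⟩
    (toℕ y + (n ∸ toℕ z)) % n  ≡⟨ m<n⇒m%n≡m y+[n∸z]<n ⟩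
    toℕ y + (n ∸ toℕ z)        ≡⟨ m∸[n∸o]≡o+[m∸n] z≤n (<⇒≤ y<z) ⟨
    n ∸ (toℕ z ∸ toℕ y)        ∎
    where
    z≤n = <⇒≤ (toℕ<n z)
    y+[n∸z]<n : toℕ y + (n ∸ toℕ z) < n
    y+[n∸z]<n = <-≤-trans (+-monoˡ-< (n ∸ toℕ z) y<z) (≤-reflexive (m+[n∸m]≡n z≤n))

  length-D : (B A : List (Fin n)) → length (D B A) ≡ length B * length A
  length-D [] A = refl
  length-D (y ∷ B) A = begin
    length (map (y ⊖_) A ++ D B A)          ≡⟨ length-++ (map (y ⊖_) A) ⟩
    length (map (y ⊖_) A) + length (D B A)  ≡⟨ cong₂ _+_ (length-map (y ⊖_) A) (length-D B A) ⟩
    length A + length B * length A          ∎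

  ∈-D⁺ : ∀ {B A : List (Fin n)} {y z} → y ∈ B → z ∈ A → y ⊖ z ∈ D B A
  ∈-D⁺ {A = A} (here refl) z∈A = ∈-++⁺ˡ (∈-map⁺ _ z∈A)
  ∈-D⁺ {B = y ∷ _} {A} (there y′∈B) z∈A = ∈-++⁺ʳ (map (y ⊖_) A) (∈-D⁺ y′∈B z∈A)

  ∈-nonzeros⁻ : ∀ {g} → g ∈ nonzeros n → 0 < toℕ g
  ∈-nonzeros⁻ g∈ = n≢0⇒n>0 (proj₂ (∈-filter⁻ (λ g → ¬? (toℕ g ≟ 0)) {xs = allFin n} g∈))

  nonzeros-unique : Unique (nonzeros n)
  nonzeros-unique = Uniqueₚ.filter⁺ (λ g → ¬? (toℕ g ≟ 0)) (Uniqueₚ.allFin⁺ n)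

length-nonzeros : ∀ m → length (nonzeros (suc m)) ≡ m
length-nonzeros m =
  trans (cong length (filter-all (λ g → ¬? (toℕ g ≟ 0)) (Allₚ.tabulate⁺ {n = m} {f = Fin.suc} λ _ ())))
        (length-tabulate {n = m} Fin.suc)

nonzeros⊆D⇒D↭nonzeros : ∀ {m} {B A : List (Fin (suc m))} → length B * length A ≡ m →
                        nonzeros (suc m) ⊆ D B A → D B A ↭ nonzeros (suc m)
nonzeros⊆D⇒D↭nonzeros {m} {B} {A} |B||A|≡m nonzeros⊆D =
  ↭-sym (unique-⊆-length≤⇒↭ nonzeros-unique nonzeros⊆D
    (≤-reflexive (trans (length-D B A) (trans |B||A|≡m (sym (length-nonzeros m))))))

pair-IsSEDF : ∀ {n ℓ} .{{_ : NonZero n}} {A B : List (Fin n)} →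
              length A ≡ ℓ → length B ≡ ℓ → Unique A → Unique B → (∀ g → g ∈ A → ¬ g ∈ B) →
              D A B ↭ nonzeros n → D B A ↭ nonzeros n → IsSEDF n 2 ℓ 1 (pair A B)
pair-IsSEDF |A| |B| A! B! A∩B≡∅ DAB↭ DBA↭ = record
  { m≥2        = ≤-refl
  ; sizes      = λ { zero → |A| ; (suc zero) → |B| }
  ; distinct   = λ { zero → A! ; (suc zero) → B! }
  ; disjoint   = λ { zero zero 0≢0 → contradiction refl 0≢0
                   ; zero (suc zero) _ → A∩B≡∅
                   ; (suc zero) zero _ g g∈B g∈A → A∩B≡∅ g g∈A g∈B
                   ; (suc zero) (suc zero) 1≢1 → contradiction refl 1≢1 }
  ; difference = λ { zero → ++⁺ʳ [] DAB↭ ; (suc zero) → ++⁺ʳ [] DBA↭ }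
  }

module AlphaValuation {a : ℕ} {f : Vertex a → ℕ} {x : ℕ} (α : IsAlphaValuation a f x) where
  open IsAlphaValuation α

  n : ℕ
  n = suc (a * a)

  small? : Decidable (λ v → f v ≤ x)
  small? v = f v ≤? x

  large? : Decidable (λ v → ¬ f v ≤ x)
  large? v = ¬? (small? v)

  label : Vertex a → Fin n
  label v = f v mod n

  toℕ-label : ∀ v → toℕ (label v) ≡ f v
  toℕ-label v = toℕ-mod (s≤s (bounded v))

  label-injective : ∀ {u v} → label u ≡ label v → u ≡ v
  label-injective {u} {v} lu≡lv = injective u v (subst₂ _≡_ (toℕ-label u) (toℕ-label v) (cong toℕ lu≡lv))

  toℕ-label-⊖-≥ : ∀ {u v} → f u ≤ f v → toℕ (label v ⊖ label u) ≡ f v ∸ f u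
  toℕ-label-⊖-≥ {u} {v} fu≤fv = trans (toℕ-⊖-≥ (subst₂ _≤_ (sym (toℕ-label u)) (sym (toℕ-label v)) fu≤fv))
                                      (cong₂ _∸_ (toℕ-label v) (toℕ-label u))

  toℕ-label-⊖-< : ∀ {u v} → f u < f v → toℕ (label u ⊖ label v) ≡ n ∸ (f v ∸ f u)
  toℕ-label-⊖-< {u} {v} fu<fv = trans (toℕ-⊖-< (subst₂ _<_ (sym (toℕ-label u)) (sym (toℕ-label v)) fu<fv))
                                      (cong (n ∸_) (cong₂ _∸_ (toℕ-label v) (toℕ-label u)))

  ≤x-separates : Separates (λ v → f v ≤ x)
  ≤x-separates i j with threshold i j
  ... | inj₁ (i≤x , x<j) = inj₁ (i≤x , <⇒≱ x<j)
  ... | inj₂ (j≤x , x<i) = inj₂ (<⇒≱ x<i , j≤x)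

  length-Vsmall : length (Vsmall a f x) ≡ a
  length-Vsmall = trans (length-map label (filter small? (allVertices a)))
                        (length-filter-separating small? ≤x-separates)

  length-Vlarge : length (Vlarge a f x) ≡ a
  length-Vlarge = trans (length-map label (filter large? (allVertices a)))
                        (length-filter-separating large? (¬-separates {P = λ v → f v ≤ x} ≤x-separates))

  Vsmall-unique : Unique (Vsmall a f x)
  Vsmall-unique = Uniqueₚ.map⁺ label-injective (Uniqueₚ.filter⁺ small? (allVertices-unique a))

  Vlarge-unique : Unique (Vlarge a f x)
  Vlarge-unique = Uniqueₚ.map⁺ label-injective (Uniqueₚ.filter⁺ large? (allVertices-unique a))

  Vsmall∩Vlarge≡∅ : ∀ g → g ∈ Vsmall a f x → ¬ g ∈ Vlarge a f x
  Vsmall∩Vlarge≡∅ g g∈small g∈large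
    with ∈-map∘filter⁻ label small? {xs = allVertices a} g∈small
       | ∈-map∘filter⁻ label large? {xs = allVertices a} g∈large
  ... | u , _ , refl , fu≤x | v , _ , lu≡lv , fv≰x = fv≰x (subst (λ w → f w ≤ x) (label-injective lu≡lv) fu≤x)

  label-small : ∀ {v} → f v ≤ x → label v ∈ Vsmall a f x
  label-small {v} fv≤x = ∈-map⁺ label (∈-filter⁺ small? (∈-allVertices v) fv≤x)

  label-large : ∀ {v} → x < f v → label v ∈ Vlarge a f x
  label-large {v} x<fv = ∈-map⁺ label (∈-filter⁺ large? (∈-allVertices v) (<⇒≱ x<fv))

  record Realisation (d : ℕ) : Set where
    field
      small large : Vertex a
      small≤x     : f small ≤ x
      x<large     : x < f large
      gap         : f large ∸ f small ≡ d

    small<large : f small < f large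
    small<large = ≤-<-trans small≤x x<large

  realise : ∀ {d} → 1 ≤ d → d ≤ a * a → Realisation d
  realise d≥1 d≤a² with diffs-onto _ d≥1 d≤a²
  ... | i , j , ∣i-j∣≡d with threshold i j
  ... | inj₁ (i≤x , x<j) = record
    { small = inj₁ i ; large = inj₂ j ; small≤x = i≤x ; x<large = x<j
    ; gap = trans (sym (m≤n⇒∣m-n∣≡n∸m (<⇒≤ (≤-<-trans i≤x x<j)))) ∣i-j∣≡d }
  ... | inj₂ (j≤x , x<i) = record
    { small = inj₂ j ; large = inj₁ i ; small≤x = j≤x ; x<large = x<i
    ; gap = trans (sym (m≤n⇒∣m-n∣≡n∸m (<⇒≤ (≤-<-trans j≤x x<i))))
                  (trans (∣-∣-comm (f (inj₂ j)) (f (inj₁ i))) ∣i-j∣≡d) }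

  nonzeros⊆D-large-small : nonzeros n ⊆ D (Vlarge a f x) (Vsmall a f x)
  nonzeros⊆D-large-small {g} g∈ =
    subst (_∈ D (Vlarge a f x) (Vsmall a f x)) large⊖small≡g (∈-D⁺ (label-large x<large) (label-small small≤x))
    where
    open Realisation (realise (∈-nonzeros⁻ g∈) (s≤s⁻¹ (toℕ<n g)))
    large⊖small≡g : label large ⊖ label small ≡ g
    large⊖small≡g = toℕ-injective (trans (toℕ-label-⊖-≥ (<⇒≤ small<large)) gap)

  -- small − large is −(large − small) = n − (large − small), so realise the gap n − g.
  nonzeros⊆D-small-large : nonzeros n ⊆ D (Vsmall a f x) (Vlarge a f x)
  nonzeros⊆D-small-large {g} g∈ =
    subst (_∈ D (Vsmall a f x) (Vlarge a f x)) small⊖large≡g (∈-D⁺ (label-small small≤x) (label-large x<large))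
    where
    open Realisation (realise (m<n⇒0<n∸m (toℕ<n g)) (∸-monoʳ-≤ n (∈-nonzeros⁻ g∈)))
    small⊖large≡g : label small ⊖ label large ≡ g
    small⊖large≡g = toℕ-injective (begin
      toℕ (label small ⊖ label large)  ≡⟨ toℕ-label-⊖-< small<large ⟩
      n ∸ (f large ∸ f small)          ≡⟨ cong (n ∸_) gap ⟩
      n ∸ (n ∸ toℕ g)                  ≡⟨ m∸[m∸n]≡n (<⇒≤ (toℕ<n g)) ⟩
      toℕ g                            ∎)

  D-small-large↭nonzeros : D (Vsmall a f x) (Vlarge a f x) ↭ nonzeros n
  D-small-large↭nonzeros = nonzeros⊆D⇒D↭nonzeros {B = Vsmall a f x} {Vlarge a f x}
                             (cong₂ _*_ length-Vsmall length-Vlarge) nonzeros⊆D-small-large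

  D-large-small↭nonzeros : D (Vlarge a f x) (Vsmall a f x) ↭ nonzeros n
  D-large-small↭nonzeros = nonzeros⊆D⇒D↭nonzeros {B = Vlarge a f x} {Vsmall a f x}
                             (cong₂ _*_ length-Vlarge length-Vsmall) nonzeros⊆D-large-small

lemma3p2 : (a : ℕ) (f : Vertex a → ℕ) (x : ℕ) → IsAlphaValuation a f x →
             IsSEDF (suc (a * a)) 2 a 1 (pair (Vsmall a f x) (Vlarge a f x))
lemma3p2 a f x α =
  pair-IsSEDF length-Vsmall length-Vlarge Vsmall-unique Vlarge-unique Vsmall∩Vlarge≡∅
              D-small-large↭nonzeros D-large-small↭nonzeros
  where open AlphaValuation α
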